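{- For any graphs $G_1$ and $G_2$, $vs_{\Delta}(G_1\vee G_2)\leq 2$.
   Context: All graphs are finite, simple and have at least one vertex. The join $G_1\vee G_2$ has vertex set $V(G_1)\cup V(G_2)$ and edge set $E(G_1)\cup E(G_2)\cup\{uv: u\in V(G_1), v\in V(G_2)\}$. $\Delta$ is the maximum degree. For a graph invariant $\rho$, the $\rho$-vertex stability number $vs_{\rho}(G)$ is the minimum number of vertices of $G$ whose removal results in a graph $H\subseteq G$ with $\rho(H)\neq\rho(G)$ or with $E(H)=\emptyset$. -}

module Defs where

open import Data.Bool using (Bool; true; false; not; _∧_; if_then_else_)
open import Data.Nat using (ℕ; zero; suc; _+_; _⊔_; _≤_)
open import Data.Fin using (Fin; splitAt)
open import Data.Fin.Subset using (Subset; inside; outside)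
open import Data.Vec using (lookup)
open import Data.List using (List; map; foldr; allFin)
open import Data.Nat.ListAction using (sum)
open import Data.Sum using (_⊎_; inj₁; inj₂)
open import Relation.Binary.PropositionalEquality using (_≡_; refl)

record Graph : Set where
  field
    n      : ℕ
    nonempty : 1 ≤ n
    adj    : Fin n → Fin n → Bool
    sym    : ∀ u v → adj u v ≡ adj v u
    irrefl : ∀ v → adj v v ≡ false
open Graph public

joinAdj : ∀ {n₁ n₂} → (Fin n₁ → Fin n₁ → Bool) → (Fin n₂ → Fin n₂ → Bool)
        → Fin (n₁ + n₂) → Fin (n₁ + n₂) → Bool
joinAdj {n₁} a b x y with splitAt n₁ x | splitAt n₁ y
... | inj₁ i | inj₁ j = a i j
... | inj₂ i | inj₂ j = b i j
... | inj₁ _ | inj₂ _ = true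
... | inj₂ _ | inj₁ _ = true

joinAdj-sym : ∀ {n₁ n₂} (a : Fin n₁ → Fin n₁ → Bool) (b : Fin n₂ → Fin n₂ → Bool)
  → (∀ u v → a u v ≡ a v u) → (∀ u v → b u v ≡ b v u)
  → ∀ x y → joinAdj a b x y ≡ joinAdj a b y x
joinAdj-sym {n₁} a b sa sb x y with splitAt n₁ x | splitAt n₁ y
... | inj₁ i | inj₁ j = sa i j
... | inj₂ i | inj₂ j = sb i j
... | inj₁ _ | inj₂ _ = refl
... | inj₂ _ | inj₁ _ = refl

joinAdj-irrefl : ∀ {n₁ n₂} (a : Fin n₁ → Fin n₁ → Bool) (b : Fin n₂ → Fin n₂ → Bool)
  → (∀ v → a v v ≡ false) → (∀ v → b v v ≡ false)
  → ∀ x → joinAdj a b x x ≡ false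
joinAdj-irrefl {n₁} a b ia ib x with splitAt n₁ x
... | inj₁ i = ia i
... | inj₂ i = ib i

≤-+ʳ : ∀ {m} n → 1 ≤ m → 1 ≤ m + n
≤-+ʳ n (Data.Nat.s≤s _) = Data.Nat.s≤s Data.Nat.z≤n

_∨G_ : Graph → Graph → Graph
G₁ ∨G G₂ = record
  { n = n G₁ + n G₂
  ; nonempty = ≤-+ʳ (n G₂) (nonempty G₁)
  ; adj = joinAdj (adj G₁) (adj G₂)
  ; sym = joinAdj-sym (adj G₁) (adj G₂) (sym G₁) (sym G₂)
  ; irrefl = joinAdj-irrefl (adj G₁) (adj G₂) (irrefl G₁) (irrefl G₂)
  }

-- Vertex deletion: G - S is the subgraph of G induced by the vertices
-- outside S (lookup S v ≡ outside means v is kept).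
kept : ∀ {m} → Subset m → Fin m → Bool
kept S v = not (lookup S v)

degreeIn : (G : Graph) → Subset (n G) → Fin (n G) → ℕ
degreeIn G S v = sum (map (λ u → if kept S u ∧ adj G v u then 1 else 0) (allFin (n G)))

ΔIn : (G : Graph) → Subset (n G) → ℕ
ΔIn G S = foldr _⊔_ 0 (map (λ v → if kept S v then degreeIn G S v else 0) (allFin (n G)))

Δ : Graph → ℕ
Δ G = ΔIn G (Data.Fin.Subset.⊥)

EdgelessIn : (G : Graph) → Subset (n G) → Set
EdgelessIn G S = ∀ u v → lookup S u ≡ outside → lookup S v ≡ outside → adj G u v ≡ false

-- Key observation: if a vertex set S leaves at least one vertex, and every
-- surviving vertex has a neighbour in S, then every surviving vertex loses
-- at least one unit of degree, so Δ(G - S) < Δ(G).  In the join every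
-- vertex of one side is adjacent to every vertex of the other side, so a
-- set containing a vertex of each side has this property.
--
-- The
-- theorem uses S = {x₁, x₂} (one vertex per side) when G₁ has a second
-- vertex that survives, and S = V(G₁) (a single vertex) otherwise.
module Submission where

open import Defs
open import Data.Nat using (_≤_)
open import Data.Fin using (Fin)
open import Data.Fin.Subset using (Subset; outside; ∣_∣)
open import Data.Vec using (lookup)
open import Data.Product using (Σ; ∃; _×_)
open import Data.Sum using (_⊎_)
open import Relation.Binary.PropositionalEquality using (_≡_; _≢_)

open import Data.Bool using (Bool; true; false; not; _∧_; if_then_else_)
open import Data.Nat using (ℕ; suc; _+_; _⊔_; _<_; z≤n; s≤s; _≤?_)
open import Data.Nat.Properties
  using (≤-refl; ≤-trans; ≤-reflexive; <-≤-trans; ≤-<-trans; <⇒≢; <⇒≤; ≰⇒>;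
         +-mono-≤; +-mono-<-≤; +-mono-≤-<; ⊔-lub; m≤m⊔n; m≤n⊔m; module ≤-Reasoning)
open import Data.Nat.ListAction using (sum)
open import Data.Fin using (zero; suc; _↑ˡ_; _↑ʳ_; splitAt)
open import Data.Fin.Properties using (splitAt-↑ˡ; splitAt-↑ʳ; splitAt⁻¹-↑ˡ; splitAt⁻¹-↑ʳ)
open import Data.Fin.Subset using (inside; ⁅_⁆; ⊤; ⊥)
open import Data.Fin.Subset.Properties using (x∈⁅x⁆; ∣⁅x⁆∣≡1; ∣⊤∣≡n; ∣⊥∣≡0)
open import Data.Vec using ([]; _∷_; _++_)
open import Data.Vec.Properties using (lookup-replicate; lookup-++ˡ; lookup-++ʳ; []=⇒lookup)
open import Data.List using (List; map; foldr; allFin) renaming ([] to []ₗ; _∷_ to _∷ₗ_)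
open import Data.List.Relation.Unary.Any using (here; there)
open import Data.List.Membership.Propositional using () renaming (_∈_ to _∈ₗ_)
open import Data.List.Membership.Propositional.Properties using (∈-allFin)
open import Data.Product using (_,_)
open import Data.Sum using (inj₁; inj₂)
open import Relation.Nullary using (yes; no)
open import Relation.Binary.PropositionalEquality
  using (refl; trans; cong; cong₂; subst) renaming (sym to ≡-sym)

sum-mono-≤ : ∀ {A : Set} (f g : A → ℕ) (xs : List A) →
  (∀ x → f x ≤ g x) → sum (map f xs) ≤ sum (map g xs)
sum-mono-≤ f g []ₗ      f≤g = z≤n
sum-mono-≤ f g (x ∷ₗ xs)    f≤g = +-mono-≤ (f≤g x) (sum-mono-≤ f g xs f≤g)

sum-mono-< : ∀ {A : Set} (f g : A → ℕ) (xs : List A) →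
  (∀ x → f x ≤ g x) → ∀ {y} → y ∈ₗ xs → f y < g y → sum (map f xs) < sum (map g xs)
sum-mono-< f g (x ∷ₗ xs) f≤g (here refl)  fy<gy = +-mono-<-≤ fy<gy (sum-mono-≤ f g xs f≤g)
sum-mono-< f g (x ∷ₗ xs) f≤g (there y∈xs) fy<gy = +-mono-≤-< (f≤g x) (sum-mono-< f g xs f≤g y∈xs fy<gy)

≤-maximum : ∀ {A : Set} (f : A → ℕ) (xs : List A) →
  ∀ {y} → y ∈ₗ xs → f y ≤ foldr _⊔_ 0 (map f xs)
≤-maximum f (x ∷ₗ xs) (here refl)  = m≤m⊔n (f x) _
≤-maximum f (x ∷ₗ xs) (there y∈xs) = ≤-trans (≤-maximum f xs y∈xs) (m≤n⊔m (f x) _)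

maximum-< : ∀ {A : Set} (f : A → ℕ) (xs : List A) {B : ℕ} →
  0 < B → (∀ x → f x < B) → foldr _⊔_ 0 (map f xs) < B
maximum-< f []ₗ   0<B f<B = 0<B
maximum-< f (x ∷ₗ xs) 0<B f<B = ⊔-lub (f<B x) (maximum-< f xs 0<B f<B)

kept-⊥ : ∀ {m} (u : Fin m) → kept ⊥ u ≡ true
kept-⊥ u = cong not (lookup-replicate u outside)

contribution : ∀ {m} → Subset m → Fin m → Bool → ℕ
contribution S u a = if kept S u ∧ a then 1 else 0

contribution-≤ : ∀ {m} (S : Subset m) u a → contribution S u a ≤ contribution ⊥ u a
contribution-≤ S u a rewrite kept-⊥ u with kept S u
... | true  = ≤-refl
... | false = z≤n

contribution-< : ∀ {m} (S : Subset m) u {a} →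
  lookup S u ≡ inside → a ≡ true → contribution S u a < contribution ⊥ u a
contribution-< S u u∈S refl rewrite kept-⊥ u | u∈S = s≤s z≤n

degree-drops : (G : Graph) (S : Subset (n G)) (v u : Fin (n G)) →
  lookup S u ≡ inside → adj G v u ≡ true → degreeIn G S v < degreeIn G ⊥ v
degree-drops G S v u u∈S vu =
  sum-mono-< (λ w → contribution S w (adj G v w)) (λ w → contribution ⊥ w (adj G v w))
    (allFin (n G)) (λ w → contribution-≤ S w (adj G v w)) (∈-allFin u)
    (contribution-< S u u∈S vu)

degree≤Δ : (G : Graph) (v : Fin (n G)) → degreeIn G ⊥ v ≤ Δ G
degree≤Δ G v =
  subst (_≤ Δ G) (cong (λ b → if b then degreeIn G ⊥ v else 0) (kept-⊥ v))
    (≤-maximum (λ w → if kept ⊥ w then degreeIn G ⊥ w else 0) (allFin (n G)) (∈-allFin v))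

Dominates : (G : Graph) → Subset (n G) → Set
Dominates G S = ∀ v → lookup S v ≡ outside → ∃ λ u → lookup S u ≡ inside × adj G v u ≡ true

deleting-a-dominating-set-lowers-Δ : (G : Graph) (S : Subset (n G)) (w : Fin (n G)) →
  lookup S w ≡ outside → Dominates G S → ΔIn G S < Δ G
deleting-a-dominating-set-lowers-Δ G S w w∉S dom =
  maximum-< (λ v → if kept S v then degreeIn G S v else 0) (allFin (n G)) 0<Δ entry<Δ
  where
  survivor<Δ : ∀ v → lookup S v ≡ outside → degreeIn G S v < Δ G
  survivor<Δ v v∉S with dom v v∉S
  ... | u , u∈S , vu = <-≤-trans (degree-drops G S v u u∈S vu) (degree≤Δ G v)

  0<Δ : 0 < Δ G
  0<Δ = ≤-<-trans z≤n (survivor<Δ w w∉S)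

  entry<Δ : ∀ v → (if kept S v then degreeIn G S v else 0) < Δ G
  entry<Δ v with lookup S v in v∈?S
  ... | true  = 0<Δ
  ... | false = survivor<Δ v v∈?S

data Side {n₁ n₂ : ℕ} : Fin (n₁ + n₂) → Set where
  left  : (i : Fin n₁) → Side (i ↑ˡ n₂)
  right : (j : Fin n₂) → Side (n₁ ↑ʳ j)

side : ∀ n₁ {n₂} (v : Fin (n₁ + n₂)) → Side v
side n₁ v with splitAt n₁ v in eq
... | inj₁ i = subst Side (splitAt⁻¹-↑ˡ eq) (left i)
... | inj₂ j = subst Side (splitAt⁻¹-↑ʳ eq) (right j)

left-right-adjacent : (G₁ G₂ : Graph) (i : Fin (n G₁)) (j : Fin (n G₂)) →
  adj (G₁ ∨G G₂) (i ↑ˡ n G₂) (n G₁ ↑ʳ j) ≡ true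
left-right-adjacent G₁ G₂ i j rewrite splitAt-↑ˡ (n G₁) i (n G₂) | splitAt-↑ʳ (n G₁) (n G₂) j = refl

right-left-adjacent : (G₁ G₂ : Graph) (i : Fin (n G₁)) (j : Fin (n G₂)) →
  adj (G₁ ∨G G₂) (n G₁ ↑ʳ j) (i ↑ˡ n G₂) ≡ true
right-left-adjacent G₁ G₂ i j rewrite splitAt-↑ˡ (n G₁) i (n G₂) | splitAt-↑ʳ (n G₁) (n G₂) j = refl

join-dominates : (G₁ G₂ : Graph) (P : Subset (n G₁)) (Q : Subset (n G₂)) →
  (∀ i → lookup P i ≡ outside → ∃ λ j → lookup Q j ≡ inside) →
  (∀ j → lookup Q j ≡ outside → ∃ λ i → lookup P i ≡ inside) →
  Dominates (G₁ ∨G G₂) (P ++ Q)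
join-dominates G₁ G₂ P Q P-seen Q-seen v v∉S with side (n G₁) v
... | left i with P-seen i (trans (≡-sym (lookup-++ˡ P Q i)) v∉S)
...   | j , j∈Q = n G₁ ↑ʳ j , trans (lookup-++ʳ P Q j) j∈Q , left-right-adjacent G₁ G₂ i j
join-dominates G₁ G₂ P Q P-seen Q-seen v v∉S | right j with Q-seen j (trans (≡-sym (lookup-++ʳ P Q j)) v∉S)
...   | i , i∈P = i ↑ˡ n G₂ , trans (lookup-++ˡ P Q i) i∈P , right-left-adjacent G₁ G₂ i j

∣++∣ : ∀ {m k} (p : Subset m) (q : Subset k) → ∣ p ++ q ∣ ≡ ∣ p ∣ + ∣ q ∣
∣++∣ []            q = refl
∣++∣ (inside ∷ p)  q = cong suc (∣++∣ p q)
∣++∣ (outside ∷ p) q = ∣++∣ p q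

lookup-⁅x⁆ : ∀ {m} (x : Fin m) → lookup ⁅ x ⁆ x ≡ inside
lookup-⁅x⁆ x = []=⇒lookup (x∈⁅x⁆ x)

two-vertices : ∀ {m} → 2 ≤ m → Σ (Fin m) λ x → Σ (Fin m) λ w → lookup ⁅ x ⁆ w ≡ outside
two-vertices (s≤s (s≤s _)) = zero , suc zero , refl

vertex : (G : Graph) → Fin (n G)
vertex G with n G | nonempty G
... | suc m | s≤s _ = zero

-- A set of at most two vertices whose deletion leaves a vertex and
-- changes Δ or leaves no edges: a witness of vs_Δ(G) ≤ 2.
Destabilising : Graph → Set
Destabilising G =
  Σ (Subset (n G)) λ S →
    (∣ S ∣ ≤ 2) × (∃ λ (v : Fin (n G)) → lookup S v ≡ outside)
    × ((ΔIn G S ≢ Δ G) ⊎ EdgelessIn G S)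

dominating-set-destabilises : (G : Graph) (S : Subset (n G)) → ∣ S ∣ ≤ 2 →
  (w : Fin (n G)) → lookup S w ≡ outside → Dominates G S → Destabilising G
dominating-set-destabilises G S card w w∉S dom =
  S , card , (w , w∉S) , inj₁ (<⇒≢ (deleting-a-dominating-set-lowers-Δ G S w w∉S dom))

delete-one-per-side : (G₁ G₂ : Graph) → 2 ≤ n G₁ → Destabilising (G₁ ∨G G₂)
delete-one-per-side G₁ G₂ 2≤n₁ with two-vertices 2≤n₁
... | x₁ , w , w∉⁅x₁⁆ =
  dominating-set-destabilises (G₁ ∨G G₂) (⁅ x₁ ⁆ ++ ⁅ x₂ ⁆) card (w ↑ˡ n G₂) w∉S
    (join-dominates G₁ G₂ ⁅ x₁ ⁆ ⁅ x₂ ⁆ (λ _ _ → x₂ , lookup-⁅x⁆ x₂) (λ _ _ → x₁ , lookup-⁅x⁆ x₁))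
  where
  x₂ : Fin (n G₂)
  x₂ = vertex G₂
  card : ∣ ⁅ x₁ ⁆ ++ ⁅ x₂ ⁆ ∣ ≤ 2
  card = ≤-reflexive (trans (∣++∣ ⁅ x₁ ⁆ ⁅ x₂ ⁆) (cong₂ _+_ (∣⁅x⁆∣≡1 x₁) (∣⁅x⁆∣≡1 x₂)))
  w∉S : lookup (⁅ x₁ ⁆ ++ ⁅ x₂ ⁆) (w ↑ˡ n G₂) ≡ outside
  w∉S = trans (lookup-++ˡ ⁅ x₁ ⁆ ⁅ x₂ ⁆ w) w∉⁅x₁⁆

delete-left-side : (G₁ G₂ : Graph) → n G₁ < 2 → Destabilising (G₁ ∨G G₂)
delete-left-side G₁ G₂ n₁<2 =
  dominating-set-destabilises (G₁ ∨G G₂) (all₁ ++ none₂) card (n G₁ ↑ʳ vertex G₂) w∉S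
    (join-dominates G₁ G₂ all₁ none₂ no-left-survivor
      (λ _ _ → vertex G₁ , lookup-replicate (vertex G₁) inside))
  where
  all₁ : Subset (n G₁)
  all₁ = ⊤
  none₂ : Subset (n G₂)
  none₂ = ⊥
  card : ∣ all₁ ++ none₂ ∣ ≤ 2
  card = begin
    ∣ all₁ ++ none₂ ∣        ≡⟨ ∣++∣ all₁ none₂ ⟩
    ∣ all₁ ∣ + ∣ none₂ ∣     ≡⟨ cong₂ _+_ (∣⊤∣≡n (n G₁)) (∣⊥∣≡0 (n G₂)) ⟩
    n G₁ + 0                ≤⟨ +-mono-≤ (<⇒≤ n₁<2) z≤n ⟩
    2                       ∎
    where open ≤-Reasoning
  w∉S : lookup (all₁ ++ none₂) (n G₁ ↑ʳ vertex G₂) ≡ outside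
  w∉S = trans (lookup-++ʳ all₁ none₂ (vertex G₂)) (lookup-replicate (vertex G₂) outside)
  no-left-survivor : ∀ i → lookup all₁ i ≡ outside → ∃ λ j → lookup none₂ j ≡ inside
  no-left-survivor i i∉all₁ with trans (≡-sym (lookup-replicate i inside)) i∉all₁
  ... | ()

mainTheorem16 : (G₁ G₂ : Graph) →
    Σ (Subset (n (G₁ ∨G G₂))) λ S →
    (∣ S ∣ ≤ 2)
    × (∃ λ (v : Fin (n (G₁ ∨G G₂))) → lookup S v ≡ outside)
    × ((ΔIn (G₁ ∨G G₂) S ≢ Δ (G₁ ∨G G₂)) ⊎ EdgelessIn (G₁ ∨G G₂) S)
mainTheorem16 G₁ G₂ with 2 ≤? n G₁
... | yes 2≤n₁ = delete-one-per-side G₁ G₂ 2≤n₁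
... | no n₁≱2  = delete-left-side G₁ G₂ (≰⇒> n₁≱2)
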